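{- For all terms $M, M'$, all values $V, V'$ and every variable $x$: if $M\Rrightarrow M'$ and $V\Rrightarrow V'$, then $M\{V/x\}\Rrightarrow M'\{V'/x\}$.
   Context: Terms and values of the call-by-value $\lambda$-calculus are defined by mutual induction from a countably infinite set of variables: values $V ::= x \mid \lambda x.M$ and terms $M,N,L ::= V \mid MN$, up to $\alpha$-conversion, application associating to the left; $\mathrm{fv}(M)$ is the set of free variables and $M\{V/x\}$ capture-avoiding substitution of a value. $^*$ denotes reflexive-transitive closure. In all rules below $m\ge0$ and $V,V'$ range over values. Head $\beta_v$-reduction $\to_{h\beta_v}$: least relation with $(\lambda x.M)V M_1\dots M_m \to_{h\beta_v} M\{V/x\}M_1\dots M_m$, and if $N\to_{h\beta_v}N'$ then $VNM_1\dots M_m\to_{h\beta_v}VN'M_1\dots M_m$. Head $\sigma$-reduction $\to_{h\sigma}$: least relation with $(\lambda x.M)NLM_1\dots M_m\to_{h\sigma}(\lambda x.ML)NM_1\dots M_m$ ($x\notin\mathrm{fv}(L)$), $V((\lambda x.L)N)M_1\dots M_m\to_{h\sigma}(\lambda x.VL)NM_1\dots M_m$ ($x\notin\mathrm{fv}(V)$), and if $N\to_{h\sigma}N'$ then $VNM_1\dots M_m\to_{h\sigma}VN'M_1\dots M_m$. Parallel reduction $\Rightarrow$ is the least relation closed under: ($\beta_v$) if $V\Rightarrow V'$ and $M_i\Rightarrow M_i'$ for $0\le i\le m$ then $(\lambda x.M_0)VM_1\dots M_m\Rightarrow M_0'\{V'/x\}M_1'\dots M_m'$; ($\sigma_1$)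 if $N\Rightarrow N'$, $L\Rightarrow L'$, $M_i\Rightarrow M_i'$ for $0\le i\le m$, and $x\notin\mathrm{fv}(L)$, then $(\lambda x.M_0)NLM_1\dots M_m\Rightarrow(\lambda x.M_0'L')N'M_1'\dots M_m'$; ($\sigma_3$) if $V\Rightarrow V'$, $N\Rightarrow N'$, $L\Rightarrow L'$, $M_i\Rightarrow M_i'$ for $1\le i\le m$, and $x\notin\mathrm{fv}(V)$, then $V((\lambda x.L)N)M_1\dots M_m\Rightarrow(\lambda x.V'L')N'M_1'\dots M_m'$; ($\lambda$) if $M_i\Rightarrow M_i'$ for $0\le i\le m$ then $(\lambda x.M_0)M_1\dots M_m\Rightarrow(\lambda x.M_0')M_1'\dots M_m'$; (var) if $M_i\Rightarrow M_i'$ for $1\le i\le m$ then $xM_1\dots M_m\Rightarrow xM_1'\dots M_m'$. Internal parallel reduction $\Rightarrow_{int}$ is the least relation with: if $N\Rightarrow N'$ then $\lambda x.N\Rightarrow_{int}\lambda x.N'$; $x\Rightarrow_{int}x$; if $V\Rightarrow V'$, $N\Rightarrow_{int}N'$ and $M_i\Rightarrow M_i'$ for $1\le i\le m$, then $VNM_1\dots M_m\Rightarrow_{int}V'N'M_1'\dots M_m'$. Strong parallel reduction: $M\Rrightarrow N$ iff $M\Rightarrow N$ and there exist terms $M',M''$ with $M\to_{h\beta_v}^*M'\to_{h\sigma}^*M''\Rightarrow_{int}N$. -}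

module Defs where

open import Data.Nat using (ℕ; zero; suc; pred; _<ᵇ_; _≡ᵇ_)
open import Data.Bool using (if_then_else_)
open import Data.List using (List; []; _∷_; foldl)
open import Data.Product using (_×_; ∃-syntax)
open import Relation.Binary.Construct.Closure.ReflexiveTransitive using (Star)

-- Terms of the call-by-value λ-calculus, de Bruijn indices
-- (α-equivalence classes of named terms).
data Term : Set where
  var : ℕ → Term
  lam : Term → Term
  app : Term → Term → Term

data Value : Term → Set where
  var : (x : ℕ) → Value (var x)
  lam : (M : Term) → Value (lam M)

apps : Term → List Term → Term
apps M Ms = foldl app M Ms

shift : ℕ → Term → Term
shift c (var y) = if y <ᵇ c then var y else var (suc y)
shift c (lam M) = lam (shift (suc c) M)
shift c (app M N) = app (shift c M) (shift c N)

-- subst x V M = M{V/x}: replaces free index x by V (the indices above x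
-- are decremented, since x disappears).
subst : ℕ → Term → Term → Term
subst x V (var y) =
  if y <ᵇ x then var y else (if y ≡ᵇ x then V else var (pred y))
subst x V (lam M) = lam (subst (suc x) (shift 0 V) M)
subst x V (app M N) = app (subst x V M) (subst x V N)

_[_] : Term → Term → Term
M [ V ] = subst 0 V M

infix 4 _→hβv_ _→hσ_ _⇒_ _⇒s_ _⇒int_ _⇛_

data _→hβv_ : Term → Term → Set where
  βv   : ∀ {M V} Ms → Value V →
         apps (app (lam M) V) Ms →hβv apps (M [ V ]) Ms
  ctx  : ∀ {V N N'} Ms → Value V → N →hβv N' →
         apps (app V N) Ms →hβv apps (app V N') Ms

-- Head σ-reduction (side conditions x ∉ fv(·) are realised by shifting)
data _→hσ_ : Term → Term → Set where
  σ1  : ∀ {M N L} Ms →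
        apps (app (app (lam M) N) L) Ms →hσ apps (app (lam (app M (shift 0 L))) N) Ms
  σ3  : ∀ {V L N} Ms → Value V →
        apps (app V (app (lam L) N)) Ms →hσ apps (app (lam (app (shift 0 V) L)) N) Ms
  ctx : ∀ {V N N'} Ms → Value V → N →hσ N' →
        apps (app V N) Ms →hσ apps (app V N') Ms

mutual
  data _⇒_ : Term → Term → Set where
    βv  : ∀ {M₀ M₀' V V' Ms Ms'} → Value V → V ⇒ V' → M₀ ⇒ M₀' → Ms ⇒s Ms' →
          apps (app (lam M₀) V) Ms ⇒ apps (M₀' [ V' ]) Ms'
    σ1  : ∀ {M₀ M₀' N N' L L' Ms Ms'} → N ⇒ N' → L ⇒ L' → M₀ ⇒ M₀' → Ms ⇒s Ms' →
          apps (app (app (lam M₀) N) L) Ms ⇒ apps (app (lam (app M₀' (shift 0 L'))) N') Ms'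
    σ3  : ∀ {V V' N N' L L' Ms Ms'} → Value V → V ⇒ V' → N ⇒ N' → L ⇒ L' → Ms ⇒s Ms' →
          apps (app V (app (lam L) N)) Ms ⇒ apps (app (lam (app (shift 0 V') L')) N') Ms'
    lam : ∀ {M₀ M₀' Ms Ms'} → M₀ ⇒ M₀' → Ms ⇒s Ms' →
          apps (lam M₀) Ms ⇒ apps (lam M₀') Ms'
    var : ∀ {x Ms Ms'} → Ms ⇒s Ms' →
          apps (var x) Ms ⇒ apps (var x) Ms'

  data _⇒s_ : List Term → List Term → Set where
    []  : [] ⇒s []
    _∷_ : ∀ {M M' Ms Ms'} → M ⇒ M' → Ms ⇒s Ms' → (M ∷ Ms) ⇒s (M' ∷ Ms')

data _⇒int_ : Term → Term → Set where
  lam : ∀ {N N'} → N ⇒ N' → lam N ⇒int lam N'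
  var : ∀ {x} → var x ⇒int var x
  app : ∀ {V V' N N' Ms Ms'} → Value V → V ⇒ V' → N ⇒int N' → Ms ⇒s Ms' →
        apps (app V N) Ms ⇒int apps (app V' N') Ms'

_⇛_ : Term → Term → Set
M ⇛ N = (M ⇒ N) × ∃[ M' ] ∃[ M'' ]
          (Star _→hβv_ M M' × Star _→hσ_ M' M'' × M'' ⇒int N)

-- Substituting a value preserves each ingredient of ⇛ separately. Parallel
-- reduction and head βv/σ steps are stable under substitution of a value because
-- substitution preserves values and maps redexes to redexes (the de Bruijn
-- substitution lemmas reconcile the contracta). Internal reduction is stable
-- once the substituted value itself reduces internally, and a value does: it has
-- no head redex, so the head sequences in V ⇛ V′ are empty.
module Submission where

open import Data.Bool using (true; false)
open import Data.List using ([]; _∷_; map; _++_)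
open import Data.Nat using (ℕ; zero; suc; _<ᵇ_; _≡ᵇ_; _<_; _≤_; z≤n; s≤s; z<s; s<s; _<?_)
open import Data.Nat.Properties
  using (<ᵇ⇒<; <⇒<ᵇ; ≡ᵇ⇒≡; ≡⇒≡ᵇ; <-irrefl; ≤⇒≯; ≮⇒≥; ≤-trans; <-≤-trans; m<n⇒m<1+n; m≤n⇒m≤1+n)
open import Data.Product using (_,_)
open import Relation.Binary.PropositionalEquality using (_≡_; refl; sym; trans; cong; cong₂; subst₂)
open import Relation.Binary.Construct.Closure.ReflexiveTransitive using (ε; _◅_; gmap)
open import Relation.Nullary using (¬_; yes; no; contradiction)
open import Defs
open import Algebra.Morphism.Definitions Term Term _≡_ using (Homomorphic₂)

data Position (x : ℕ) : ℕ → Set where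
  below : ∀ {y} → y < x → Position x y
  at    : Position x x
  above : ∀ {y} → x ≤ y → Position x (suc y)

position : ∀ x y → Position x y
position zero    zero    = at
position zero    (suc y) = above z≤n
position (suc x) zero    = below z<s
position (suc x) (suc y) with position x y
... | below y<x = below (s<s y<x)
... | at        = at
... | above x≤y = above (s≤s x≤y)

shift-var-< : ∀ {c y} → y < c → shift c (var y) ≡ var y
shift-var-< {c} {y} y<c with y <ᵇ c | <⇒<ᵇ y<c
... | true | _ = refl

shift-var-≥ : ∀ {c y} → c ≤ y → shift c (var y) ≡ var (suc y)
shift-var-≥ {c} {y} c≤y with y <ᵇ c | <ᵇ⇒< y c
... | true  | y<c = contradiction (y<c _) (≤⇒≯ c≤y)
... | false | _   = refl

subst-var-< : ∀ {x y V} → y < x → subst x V (var y) ≡ var y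
subst-var-< {x} {y} y<x with y <ᵇ x | <⇒<ᵇ y<x
... | true | _ = refl

subst-var-≡ : ∀ x {V} → subst x V (var x) ≡ V
subst-var-≡ x with x <ᵇ x | <ᵇ⇒< x x
... | true  | x<x = contradiction (x<x _) (<-irrefl refl)
... | false | _ with x ≡ᵇ x | ≡⇒≡ᵇ x x refl
...   | true | _ = refl

subst-var-> : ∀ {x y V} → x ≤ y → subst x V (var (suc y)) ≡ var y
subst-var-> {x} {y} x≤y with suc y <ᵇ x | <ᵇ⇒< (suc y) x
... | true  | y<x = contradiction (y<x _) (≤⇒≯ (m≤n⇒m≤1+n x≤y))
... | false | _ with suc y ≡ᵇ x | ≡ᵇ⇒≡ (suc y) x
...   | true  | y≡x = contradiction (s≤s x≤y) (<-irrefl (sym (y≡x _)))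
...   | false | _   = refl

shift-shift : ∀ {i c} M → i ≤ c → shift i (shift c M) ≡ shift (suc c) (shift i M)
shift-shift {i} {c} (var y) i≤c with y <? i | y <? c
... | yes y<i | _ rewrite shift-var-< (<-≤-trans y<i i≤c) | shift-var-< y<i
                        | shift-var-< (m<n⇒m<1+n (<-≤-trans y<i i≤c)) = refl
... | no y≮i | yes y<c rewrite shift-var-< y<c | shift-var-≥ (≮⇒≥ y≮i) | shift-var-< (s<s y<c) = refl
... | no y≮i | no y≮c rewrite shift-var-≥ (≮⇒≥ y≮c) | shift-var-≥ (≮⇒≥ y≮i)
                            | shift-var-≥ (m≤n⇒m≤1+n (≮⇒≥ y≮i)) | shift-var-≥ (s≤s (≮⇒≥ y≮c)) = refl
shift-shift (lam M)   i≤c = cong lam (shift-shift M (s≤s i≤c))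
shift-shift (app M N) i≤c = cong₂ app (shift-shift M i≤c) (shift-shift N i≤c)

shift-shift₀ : ∀ c M → shift (suc c) (shift 0 M) ≡ shift 0 (shift c M)
shift-shift₀ c M = sym (shift-shift M z≤n)

subst-shift-cancel : ∀ c V M → subst c V (shift c M) ≡ M
subst-shift-cancel c V (var y) with y <? c
... | yes y<c rewrite shift-var-< y<c = subst-var-< y<c
... | no y≮c  rewrite shift-var-≥ (≮⇒≥ y≮c) = subst-var-> (≮⇒≥ y≮c)
subst-shift-cancel c V (lam M)   = cong lam (subst-shift-cancel (suc c) (shift 0 V) M)
subst-shift-cancel c V (app M N) = cong₂ app (subst-shift-cancel c V M) (subst-shift-cancel c V N)

shift-subst-≤ : ∀ {c x} V M → c ≤ x → shift c (subst x V M) ≡ subst (suc x) (shift c V) (shift c M)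
shift-subst-≤ {c} {x} V (var y) c≤x with position x y
... | below y<x with y <? c
...   | yes y<c rewrite subst-var-< {V = V} y<x | shift-var-< y<c
                      | subst-var-< {V = shift c V} (m<n⇒m<1+n y<x) = refl
...   | no y≮c  rewrite subst-var-< {V = V} y<x | shift-var-≥ (≮⇒≥ y≮c)
                      | subst-var-< {V = shift c V} (s<s y<x) = refl
shift-subst-≤ {c} {x} V (var y) c≤x | at
  rewrite subst-var-≡ x {V} | shift-var-≥ c≤x | subst-var-≡ (suc x) {shift c V} = refl
shift-subst-≤ {c} {x} V (var (suc y)) c≤x | above x≤y
  rewrite subst-var-> {V = V} x≤y | shift-var-≥ (≤-trans c≤x x≤y)
        | shift-var-≥ (m≤n⇒m≤1+n (≤-trans c≤x x≤y)) | subst-var-> {V = shift c V} (s≤s x≤y) = refl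
shift-subst-≤ {c} {x} V (lam M) c≤x =
  cong lam (trans (shift-subst-≤ (shift 0 V) M (s≤s c≤x))
                  (cong (λ W → subst (suc (suc x)) W (shift (suc c) M)) (shift-shift₀ c V)))
shift-subst-≤ V (app M N) c≤x = cong₂ app (shift-subst-≤ V M c≤x) (shift-subst-≤ V N c≤x)

shift-subst-≥ : ∀ {c x} V M → x ≤ c → shift c (subst x V M) ≡ subst x (shift c V) (shift (suc c) M)
shift-subst-≥ {c} {x} V (var y) x≤c with position x y
... | below y<x rewrite subst-var-< {V = V} y<x | shift-var-< (<-≤-trans y<x x≤c)
                      | shift-var-< (m<n⇒m<1+n (<-≤-trans y<x x≤c)) | subst-var-< {V = shift c V} y<x = refl
... | at rewrite subst-var-≡ x {V} | shift-var-< (s≤s x≤c) | subst-var-≡ x {shift c V} = refl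
shift-subst-≥ {c} {x} V (var (suc y)) x≤c | above x≤y with y <? c
...   | yes y<c rewrite subst-var-> {V = V} x≤y | shift-var-< y<c | shift-var-< (s<s y<c)
                      | subst-var-> {V = shift c V} x≤y = refl
...   | no y≮c  rewrite subst-var-> {V = V} x≤y | shift-var-≥ (≮⇒≥ y≮c) | shift-var-≥ (s≤s (≮⇒≥ y≮c))
                      | subst-var-> {V = shift c V} (m≤n⇒m≤1+n x≤y) = refl
shift-subst-≥ {c} {x} V (lam M) x≤c =
  cong lam (trans (shift-subst-≥ (shift 0 V) M (s≤s x≤c))
                  (cong (λ W → subst (suc x) W (shift (suc (suc c)) M)) (shift-shift₀ c V)))
shift-subst-≥ V (app M N) x≤c = cong₂ app (shift-subst-≥ V M x≤c) (shift-subst-≥ V N x≤c)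

subst-shift₀ : ∀ x W M → subst (suc x) (shift 0 W) (shift 0 M) ≡ shift 0 (subst x W M)
subst-shift₀ x W M = sym (shift-subst-≤ W M z≤n)

subst-subst : ∀ {c x} V W M → c ≤ x →
              subst x W (subst c V M) ≡ subst c (subst x W V) (subst (suc x) (shift c W) M)
subst-subst {c} {x} V W (var y) c≤x with position c y
... | below y<c rewrite subst-var-< {V = V} y<c | subst-var-< {V = W} (<-≤-trans y<c c≤x)
                      | subst-var-< {V = shift c W} (m<n⇒m<1+n (<-≤-trans y<c c≤x))
                      | subst-var-< {V = subst x W V} y<c = refl
... | at rewrite subst-var-≡ c {V} | subst-var-< {V = shift c W} (s≤s c≤x)
               | subst-var-≡ c {subst x W V} = refl
subst-subst {c} {x} V W (var (suc y)) c≤x | above c≤y with position x y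
...   | below y<x rewrite subst-var-> {V = V} c≤y | subst-var-< {V = W} y<x
                        | subst-var-< {V = shift c W} (s<s y<x) | subst-var-> {V = subst x W V} c≤y = refl
...   | at rewrite subst-var-> {V = V} c≤y | subst-var-≡ x {W} | subst-var-≡ (suc x) {shift c W} =
  sym (subst-shift-cancel c (subst x W V) W)
subst-subst {c} {x} V W (var (suc (suc y))) c≤x | above c≤1+y | above x≤y
  rewrite subst-var-> {V = V} c≤1+y | subst-var-> {V = W} x≤y | subst-var-> {V = shift c W} (s≤s x≤y)
        | subst-var-> {V = subst x W V} (≤-trans c≤x x≤y) = refl
subst-subst {c} {x} V W (lam M) c≤x =
  cong lam (trans (subst-subst (shift 0 V) (shift 0 W) M (s≤s c≤x))
                  (cong₂ (λ V′ W′ → subst (suc c) V′ (subst (suc (suc x)) W′ M))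
                         (subst-shift₀ x W V) (shift-shift₀ c W)))
subst-subst V W (app M N) c≤x = cong₂ app (subst-subst V W M c≤x) (subst-subst V W N c≤x)

shift-[] : ∀ c M V → shift c (M [ V ]) ≡ shift (suc c) M [ shift c V ]
shift-[] c M V = shift-subst-≥ V M z≤n

subst-[] : ∀ x W M V → subst x W (M [ V ]) ≡ subst (suc x) (shift 0 W) M [ subst x W V ]
subst-[] x W M V = subst-subst V W M z≤n

shift-value : ∀ c {V} → Value V → Value (shift c V)
shift-value c (var y) with y <ᵇ c
... | true  = var y
... | false = var (suc y)
shift-value c (lam M) = lam _

subst-value : ∀ x {W V} → Value W → Value V → Value (subst x W V)
subst-value x w (var y) with y <ᵇ x
... | true = var y
... | false with y ≡ᵇ x
...   | true  = w
...   | false = var _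
subst-value x w (lam M) = lam _

apps-++ : ∀ P Ms Ns → apps (apps P Ms) Ns ≡ apps P (Ms ++ Ns)
apps-++ P []       Ns = refl
apps-++ P (M ∷ Ms) Ns = apps-++ (app P M) Ms Ns

map-apps : ∀ {f} → Homomorphic₂ f app app → ∀ P Ms → f (apps P Ms) ≡ apps (f P) (map f Ms)
map-apps     f-hom P []       = refl
map-apps {f} f-hom P (M ∷ Ms) =
  trans (map-apps f-hom (app P M) Ms) (cong (λ Q → apps Q (map f Ms)) (f-hom P M))

shift-homomorphic : ∀ c → Homomorphic₂ (shift c) app app
shift-homomorphic c _ _ = refl

subst-homomorphic : ∀ x W → Homomorphic₂ (subst x W) app app
subst-homomorphic x W _ _ = refl

apps-image : ∀ (_~_ : Term → Term → Set) {f g} → Homomorphic₂ f app app → Homomorphic₂ g app app →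
             ∀ {P Q Q′} Ms Ns → g Q ≡ Q′ →
             apps (f P) (map f Ms) ~ apps Q′ (map g Ns) → f (apps P Ms) ~ g (apps Q Ns)
apps-image _~_ {g = g} f-hom g-hom {P} {Q} Ms Ns gQ≡Q′ =
  subst₂ _~_ (sym (map-apps f-hom P Ms))
             (sym (trans (map-apps g-hom Q Ns) (cong (λ Q′ → apps Q′ (map g Ns)) gQ≡Q′)))

_++⇒s_ : ∀ {Ms Ms′ Ns Ns′} → Ms ⇒s Ms′ → Ns ⇒s Ns′ → (Ms ++ Ns) ⇒s (Ms′ ++ Ns′)
[]              ++⇒s Ns⇒Ns′ = Ns⇒Ns′
(M⇒M′ ∷ Ms⇒Ms′) ++⇒s Ns⇒Ns′ = M⇒M′ ∷ (Ms⇒Ms′ ++⇒s Ns⇒Ns′)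

spine-⇒-apps : ∀ {X Y Ms Ms′ Ns Ns′} → (∀ {Ls Ls′} → Ls ⇒s Ls′ → apps X Ls ⇒ apps Y Ls′) →
               Ms ⇒s Ms′ → Ns ⇒s Ns′ → apps (apps X Ms) Ns ⇒ apps (apps Y Ms′) Ns′
spine-⇒-apps {X} {Y} {Ms} {Ms′} {Ns} {Ns′} spine Ms⇒Ms′ Ns⇒Ns′ =
  subst₂ _⇒_ (sym (apps-++ X Ms Ns)) (sym (apps-++ Y Ms′ Ns′)) (spine (Ms⇒Ms′ ++⇒s Ns⇒Ns′))

apps-⇒ : ∀ {W W′ Ns Ns′} → W ⇒ W′ → Ns ⇒s Ns′ → apps W Ns ⇒ apps W′ Ns′
apps-⇒ (βv v V⇒V′ M⇒M′ Ms⇒Ms′)     = spine-⇒-apps (βv v V⇒V′ M⇒M′) Ms⇒Ms′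
apps-⇒ (σ1 N⇒N′ L⇒L′ M⇒M′ Ms⇒Ms′)  = spine-⇒-apps (σ1 N⇒N′ L⇒L′ M⇒M′) Ms⇒Ms′
apps-⇒ (σ3 v V⇒V′ N⇒N′ L⇒L′ Ms⇒Ms′) = spine-⇒-apps (σ3 v V⇒V′ N⇒N′ L⇒L′) Ms⇒Ms′
apps-⇒ (lam M⇒M′ Ms⇒Ms′)           = spine-⇒-apps (lam M⇒M′) Ms⇒Ms′
apps-⇒ (var Ms⇒Ms′)                = spine-⇒-apps var Ms⇒Ms′

shift-image : ∀ (_~_ : Term → Term → Set) c {P Q Q′} Ms Ns → shift c Q ≡ Q′ →
              apps (shift c P) (map (shift c) Ms) ~ apps Q′ (map (shift c) Ns) →
              shift c (apps P Ms) ~ shift c (apps Q Ns)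
shift-image _~_ c = apps-image _~_ (shift-homomorphic c) (shift-homomorphic c)

subst-image : ∀ (_~_ : Term → Term → Set) x W W′ {P Q Q′} Ms Ns → subst x W′ Q ≡ Q′ →
              apps (subst x W P) (map (subst x W) Ms) ~ apps Q′ (map (subst x W′) Ns) →
              subst x W (apps P Ms) ~ subst x W′ (apps Q Ns)
subst-image _~_ x W W′ = apps-image _~_ (subst-homomorphic x W) (subst-homomorphic x W′)

shift-var-⇒ : ∀ c y → shift c (var y) ⇒ shift c (var y)
shift-var-⇒ c y with y <ᵇ c
... | true  = var []
... | false = var []

mutual
  shift-⇒ : ∀ c {M M′} → M ⇒ M′ → shift c M ⇒ shift c M′
  shift-⇒ c (βv {M₀' = M₀′} {V' = V′} {Ms} {Ms′} v V⇒V′ M₀⇒M₀′ Ms⇒Ms′) =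
    shift-image _⇒_ c Ms Ms′ (shift-[] c M₀′ V′)
      (βv (shift-value c v) (shift-⇒ c V⇒V′) (shift-⇒ (suc c) M₀⇒M₀′) (shift-⇒s c Ms⇒Ms′))
  shift-⇒ c (σ1 {M₀' = M₀′} {N' = N′} {L' = L′} {Ms} {Ms′} N⇒N′ L⇒L′ M₀⇒M₀′ Ms⇒Ms′) =
    shift-image _⇒_ c Ms Ms′ (cong (λ L → app (lam (app (shift (suc c) M₀′) L)) (shift c N′)) (shift-shift₀ c L′))
      (σ1 (shift-⇒ c N⇒N′) (shift-⇒ c L⇒L′) (shift-⇒ (suc c) M₀⇒M₀′) (shift-⇒s c Ms⇒Ms′))
  shift-⇒ c (σ3 {V' = V′} {N' = N′} {L' = L′} {Ms} {Ms′} v V⇒V′ N⇒N′ L⇒L′ Ms⇒Ms′) =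
    shift-image _⇒_ c Ms Ms′ (cong (λ V → app (lam (app V (shift (suc c) L′))) (shift c N′)) (shift-shift₀ c V′))
      (σ3 (shift-value c v) (shift-⇒ c V⇒V′) (shift-⇒ c N⇒N′) (shift-⇒ (suc c) L⇒L′) (shift-⇒s c Ms⇒Ms′))
  shift-⇒ c (lam {Ms = Ms} {Ms′} M₀⇒M₀′ Ms⇒Ms′) =
    shift-image _⇒_ c Ms Ms′ refl (lam (shift-⇒ (suc c) M₀⇒M₀′) (shift-⇒s c Ms⇒Ms′))
  shift-⇒ c (var {x = y} {Ms} {Ms′} Ms⇒Ms′) =
    shift-image _⇒_ c Ms Ms′ refl (apps-⇒ (shift-var-⇒ c y) (shift-⇒s c Ms⇒Ms′))

  shift-⇒s : ∀ c {Ms Ms′} → Ms ⇒s Ms′ → map (shift c) Ms ⇒s map (shift c) Ms′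
  shift-⇒s c []                = []
  shift-⇒s c (M⇒M′ ∷ Ms⇒Ms′) = shift-⇒ c M⇒M′ ∷ shift-⇒s c Ms⇒Ms′

subst-var-⇒ : ∀ x y {W W′} → W ⇒ W′ → subst x W (var y) ⇒ subst x W′ (var y)
subst-var-⇒ x y W⇒W′ with y <ᵇ x
... | true = var []
... | false with y ≡ᵇ x
...   | true  = W⇒W′
...   | false = var []

mutual
  subst-⇒ : ∀ x {W W′ M M′} → Value W → W ⇒ W′ → M ⇒ M′ → subst x W M ⇒ subst x W′ M′
  subst-⇒ x {W} {W′} w W⇒W′ (βv {M₀' = M₀′} {V' = V′} {Ms} {Ms′} v V⇒V′ M₀⇒M₀′ Ms⇒Ms′) =
    subst-image _⇒_ x W W′ Ms Ms′ (subst-[] x W′ M₀′ V′)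
      (βv (subst-value x w v) (subst-⇒ x w W⇒W′ V⇒V′)
          (subst-⇒ (suc x) (shift-value 0 w) (shift-⇒ 0 W⇒W′) M₀⇒M₀′) (subst-⇒s x w W⇒W′ Ms⇒Ms′))
  subst-⇒ x {W} {W′} w W⇒W′ (σ1 {M₀' = M₀′} {N' = N′} {L' = L′} {Ms} {Ms′} N⇒N′ L⇒L′ M₀⇒M₀′ Ms⇒Ms′) =
    subst-image _⇒_ x W W′ Ms Ms′
      (cong (λ L → app (lam (app (subst (suc x) (shift 0 W′) M₀′) L)) (subst x W′ N′)) (subst-shift₀ x W′ L′))
      (σ1 (subst-⇒ x w W⇒W′ N⇒N′) (subst-⇒ x w W⇒W′ L⇒L′)
          (subst-⇒ (suc x) (shift-value 0 w) (shift-⇒ 0 W⇒W′) M₀⇒M₀′) (subst-⇒s x w W⇒W′ Ms⇒Ms′))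
  subst-⇒ x {W} {W′} w W⇒W′ (σ3 {V' = V′} {N' = N′} {L' = L′} {Ms} {Ms′} v V⇒V′ N⇒N′ L⇒L′ Ms⇒Ms′) =
    subst-image _⇒_ x W W′ Ms Ms′
      (cong (λ V → app (lam (app V (subst (suc x) (shift 0 W′) L′))) (subst x W′ N′)) (subst-shift₀ x W′ V′))
      (σ3 (subst-value x w v) (subst-⇒ x w W⇒W′ V⇒V′) (subst-⇒ x w W⇒W′ N⇒N′)
          (subst-⇒ (suc x) (shift-value 0 w) (shift-⇒ 0 W⇒W′) L⇒L′) (subst-⇒s x w W⇒W′ Ms⇒Ms′))
  subst-⇒ x {W} {W′} w W⇒W′ (lam {Ms = Ms} {Ms′} M₀⇒M₀′ Ms⇒Ms′) =
    subst-image _⇒_ x W W′ Ms Ms′ refl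
      (lam (subst-⇒ (suc x) (shift-value 0 w) (shift-⇒ 0 W⇒W′) M₀⇒M₀′) (subst-⇒s x w W⇒W′ Ms⇒Ms′))
  subst-⇒ x {W} {W′} w W⇒W′ (var {x = y} {Ms} {Ms′} Ms⇒Ms′) =
    subst-image _⇒_ x W W′ Ms Ms′ refl (apps-⇒ (subst-var-⇒ x y W⇒W′) (subst-⇒s x w W⇒W′ Ms⇒Ms′))

  subst-⇒s : ∀ x {W W′ Ms Ms′} → Value W → W ⇒ W′ → Ms ⇒s Ms′ → map (subst x W) Ms ⇒s map (subst x W′) Ms′
  subst-⇒s x w W⇒W′ []                = []
  subst-⇒s x w W⇒W′ (M⇒M′ ∷ Ms⇒Ms′) = subst-⇒ x w W⇒W′ M⇒M′ ∷ subst-⇒s x w W⇒W′ Ms⇒Ms′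

subst-→hβv : ∀ x {W M N} → Value W → M →hβv N → subst x W M →hβv subst x W N
subst-→hβv x {W} w (βv {M} {V} Ms v) =
  subst-image _→hβv_ x W W Ms Ms (subst-[] x W M V) (βv (map (subst x W) Ms) (subst-value x w v))
subst-→hβv x {W} w (ctx Ms v N→N′) =
  subst-image _→hβv_ x W W Ms Ms refl (ctx (map (subst x W) Ms) (subst-value x w v) (subst-→hβv x w N→N′))

subst-→hσ : ∀ x {W M N} → Value W → M →hσ N → subst x W M →hσ subst x W N
subst-→hσ x {W} w (σ1 {M} {N} {L} Ms) =
  subst-image _→hσ_ x W W Ms Ms
    (cong (λ L → app (lam (app (subst (suc x) (shift 0 W) M) L)) (subst x W N)) (subst-shift₀ x W L))
    (σ1 (map (subst x W) Ms))
subst-→hσ x {W} w (σ3 {V} {L} {N} Ms v) =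
  subst-image _→hσ_ x W W Ms Ms
    (cong (λ V → app (lam (app V (subst (suc x) (shift 0 W) L))) (subst x W N)) (subst-shift₀ x W V))
    (σ3 (map (subst x W) Ms) (subst-value x w v))
subst-→hσ x {W} w (ctx Ms v N→N′) =
  subst-image _→hσ_ x W W Ms Ms refl (ctx (map (subst x W) Ms) (subst-value x w v) (subst-→hσ x w N→N′))

subst-var-⇒int : ∀ x y {W W′} → W ⇒int W′ → subst x W (var y) ⇒int subst x W′ (var y)
subst-var-⇒int x y W⇒W′ with y <ᵇ x
... | true = var
... | false with y ≡ᵇ x
...   | true  = W⇒W′
...   | false = var

subst-⇒int : ∀ x {W W′ M M′} → Value W → W ⇒ W′ → W ⇒int W′ → M ⇒int M′ → subst x W M ⇒int subst x W′ M′
subst-⇒int x w W⇒W′ W⇒intW′ (lam M⇒M′) = lam (subst-⇒ (suc x) (shift-value 0 w) (shift-⇒ 0 W⇒W′) M⇒M′)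
subst-⇒int x w W⇒W′ W⇒intW′ (var {y})   = subst-var-⇒int x y W⇒intW′
subst-⇒int x {W} {W′} w W⇒W′ W⇒intW′ (app {Ms = Ms} {Ms′} v V⇒V′ N⇒intN′ Ms⇒Ms′) =
  subst-image _⇒int_ x W W′ Ms Ms′ refl
    (app (subst-value x w v) (subst-⇒ x w W⇒W′ V⇒V′) (subst-⇒int x w W⇒W′ W⇒intW′ N⇒intN′)
         (subst-⇒s x w W⇒W′ Ms⇒Ms′))

apps-app-not-value : ∀ {M N} Ms → ¬ Value (apps (app M N) Ms)
apps-app-not-value []       ()
apps-app-not-value (_ ∷ Ms) = apps-app-not-value Ms

value-¬→hβv : ∀ {V N} → Value V → ¬ (V →hβv N)
value-¬→hβv v (βv Ms _)    = apps-app-not-value Ms v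
value-¬→hβv v (ctx Ms _ _) = apps-app-not-value Ms v

value-¬→hσ : ∀ {V N} → Value V → ¬ (V →hσ N)
value-¬→hσ v (σ1 Ms)      = apps-app-not-value Ms v
value-¬→hσ v (σ3 Ms _)    = apps-app-not-value Ms v
value-¬→hσ v (ctx Ms _ _) = apps-app-not-value Ms v

value-⇛⇒⇒int : ∀ {V V′} → Value V → V ⇛ V′ → V ⇒int V′
value-⇛⇒⇒int v (_ , _ , _ , ε , ε , V⇒intV′)  = V⇒intV′
value-⇛⇒⇒int v (_ , _ , _ , V→V₁ ◅ _ , _ , _) = contradiction V→V₁ (value-¬→hβv v)
value-⇛⇒⇒int v (_ , _ , _ , ε , V→V₁ ◅ _ , _) = contradiction V→V₁ (value-¬→hσ v)

lemma3p15 : ∀ {M M' V V' : Term} (x : ℕ) → Value V → Value V' →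
            M ⇛ M' → V ⇛ V' → subst x V M ⇛ subst x V' M'
lemma3p15 {V = V} x v _ (M⇒M′ , M₁ , M₂ , M→M₁ , M₁→M₂ , M₂⇒intM′) V⇛V′@(V⇒V′ , _) =
  subst-⇒ x v V⇒V′ M⇒M′ , subst x V M₁ , subst x V M₂ ,
  gmap (subst x V) (subst-→hβv x v) M→M₁ , gmap (subst x V) (subst-→hσ x v) M₁→M₂ ,
  subst-⇒int x v V⇒V′ (value-⇛⇒⇒int v V⇛V′) M₂⇒intM′
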